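{- Let $G$ be a minimal $(2,2)$-dominated graph. If two vertices $x$ and $y$ of $G$ are joined by at least two (parallel) edges, then at least one of $x$ and $y$ has degree $2$ in $G$.
   Context: Graphs may have multiple edges and multiple loops; the degree of a vertex is the number of incident edges plus twice the number of incident loops. A set $D\subseteq V(G)$ is a $2$-dominating set if every vertex of $V(G)\setminus D$ is joined by at least two edges (counted with multiplicity) to vertices of $D$. $G$ is $(2,2)$-dominated if there are two proper, disjoint subsets of $V(G)$ each of which is $2$-dominating. A connected graph $G$ is a minimal $(2,2)$-dominated graph if it is $(2,2)$-dominated and no proper spanning subgraph of $G$ (obtained by deleting at least one edge) is $(2,2)$-dominated. -}

module Defs where

open import Data.Nat using (ℕ; zero; suc; _+_; _≤_; _<_)
open import Data.Bool using (Bool; true; false; _∧_; _∨_; if_then_else_)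
open import Data.Fin using (Fin; _≟_)
open import Data.Fin.Subset as S using (Subset; ⊤; _∩_; _⊂_; Empty)
open import Data.Vec using (lookup)
open import Data.List using (List; length)
open import Data.List.Membership.Propositional using (_∈_)
open import Data.List.Relation.Binary.Sublist.Propositional using () renaming (_⊆_ to _⊑_)
open import Data.Product using (_×_; _,_; Σ)
open import Relation.Nullary.Decidable using (⌊_⌋)
open import Relation.Binary.PropositionalEquality using (_≡_)

-- A finite multigraph (multiple edges and loops allowed) on vertex set Fin n,
-- given by its multiset of edges as a list of endpoint pairs; (v , v) is a loop.
record Multigraph : Set where
  constructor mkGraph
  field
    n     : ℕ
    edges : List (Fin n × Fin n)
open Multigraph public

Vertex : Multigraph → Set
Vertex G = Fin (n G)

_==_ : ∀ {m} → Fin m → Fin m → Bool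
a == b = ⌊ a ≟ b ⌋

count : ∀ {A : Set} → (A → Bool) → List A → ℕ
count p List.[] = 0
count p (x List.∷ xs) = (if p x then 1 else 0) + count p xs

-- degree: each edge contributes one per endpoint equal to v (so a loop contributes 2)
sum' : ∀ {A : Set} → (A → ℕ) → List A → ℕ
sum' f List.[] = 0
sum' f (x List.∷ xs) = f x + sum' f xs

degree : (G : Multigraph) → Vertex G → ℕ
degree G v = sum' (λ { (a , b) → (if a == v then 1 else 0) + (if b == v then 1 else 0) }) (edges G)

edgesToSet : (G : Multigraph) → Vertex G → Subset (n G) → ℕ
edgesToSet G v D =
  count (λ { (a , b) → ((a == v) ∧ lookup D b) ∨ ((b == v) ∧ lookup D a) }) (edges G)

edgesBetween : (G : Multigraph) → Vertex G → Vertex G → ℕ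
edgesBetween G x y =
  count (λ { (a , b) → ((a == x) ∧ (b == y)) ∨ ((a == y) ∧ (b == x)) }) (edges G)

TwoDominating : (G : Multigraph) → Subset (n G) → Set
TwoDominating G D = ∀ (v : Vertex G) → lookup D v ≡ false → 2 ≤ edgesToSet G v D

Disjoint : ∀ {m} → Subset m → Subset m → Set
Disjoint D₁ D₂ = Empty (D₁ ∩ D₂)

TwoTwoDominated : Multigraph → Set
TwoTwoDominated G =
  Σ (Subset (n G)) λ D₁ → Σ (Subset (n G)) λ D₂ →
    (D₁ ⊂ ⊤) × (D₂ ⊂ ⊤) × Disjoint D₁ D₂ × TwoDominating G D₁ × TwoDominating G D₂

data Reach (G : Multigraph) : Vertex G → Vertex G → Set where
  here  : ∀ {u} → Reach G u u
  fwd   : ∀ {u a b} → (a , b) ∈ edges G → Reach G u a → Reach G u b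
  bwd   : ∀ {u a b} → (a , b) ∈ edges G → Reach G u b → Reach G u a

Connected : Multigraph → Set
Connected G = ∀ (u v : Vertex G) → Reach G u v

-- proper spanning subgraph: same vertices, edge multiset a sub-multiset
-- (sublist) with at least one edge deleted
MinimalTwoTwoDominated : Multigraph → Set
MinimalTwoTwoDominated G =
  Connected G × TwoTwoDominated G ×
  (∀ (E : List (Fin (n G) × Fin (n G))) → E ⊑ edges G → length E < length (edges G) →
     TwoTwoDominated (mkGraph (n G) E) → Data.Empty.⊥)
  where import Data.Empty

-- If D₁, D₂ witness (2,2)-domination, then ∁ D₂ ⊇ D₁ is 2-dominating as well, so D₂ and ∁ D₂
-- partition the vertices into two 2-dominating classes. An edge inside a class counts for no
-- vertex outside that class, so by minimality every edge crosses the partition, and the degree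
-- of any vertex is its number of edges into the other class. Deleting an edge ab keeps both
-- classes 2-dominating unless a or b has exactly two edges into the other class, i.e. degree 2;
-- minimality rules out the former, so every edge has an end of degree 2.
module Submission where

open import Defs
open import Data.Bool using (Bool; true; false; not; _∧_; _∨_; if_then_else_)
import Data.Bool.Properties as Bool
open import Data.Empty using (⊥; ⊥-elim)
open import Data.Fin using (Fin) renaming (_≟_ to _≟ᶠ_)
open import Data.Fin.Subset using (Subset; ∁; Nonempty)
open import Data.Fin.Subset.Properties using (⊆⊤; ∈⊤; x∈p∩q⁺; x∈p∩q⁻; x∈p⇒x∉∁p; x∈∁p⇒x∉p)
open import Data.List using ([]; _∷_; length)
open import Data.List.Membership.Propositional using (_∈_)
open import Data.List.Properties using (length-removeAt′)
open import Data.List.Relation.Binary.Sublist.Propositional using (_∷_; _∷ʳ_; ⊆-refl)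
  renaming (_⊆_ to _⊑_)
open import Data.List.Relation.Unary.All as All using (All)
open import Data.List.Relation.Unary.Any using (here; there; _─_)
open import Data.Nat using (ℕ; _+_; _≤_; _<_; z≤n; s≤s; s≤s⁻¹)
open import Data.Nat.Properties using (≤-refl; ≤-trans; ≤-reflexive; ≤∧≢⇒<; +-mono-≤)
import Data.Nat.Properties as ℕ
open import Algebra.Properties.CommutativeSemigroup ℕ.+-commutativeSemigroup using (x∙yz≈y∙xz)
open import Data.Product using (∃-syntax; _×_; _,_; uncurry)
open import Data.Sum as Sum using (_⊎_; inj₁; inj₂)
open import Data.Vec using (lookup)
open import Data.Vec.Properties using (lookup-map; lookup⇒[]=)
open import Function using (_∘_; case_of_)
open import Relation.Nullary using (¬_; yes; no; Dec; contradiction)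
open import Relation.Nullary.Decidable using (_×-dec_)
open import Relation.Binary.PropositionalEquality

𝟙 : Bool → ℕ
𝟙 b = if b then 1 else 0

𝟙-mono : ∀ {b c} → (b ≡ true → c ≡ true) → 𝟙 b ≤ 𝟙 c
𝟙-mono {false} _   = z≤n
𝟙-mono {true}  b⇒c rewrite b⇒c refl = ≤-refl

∧-monoʳ : ∀ c {b b′} → (b ≡ true → b′ ≡ true) → c ∧ b ≡ true → c ∧ b′ ≡ true
∧-monoʳ true  b⇒b′ = b⇒b′
∧-monoʳ false _    ()

∨-mono : ∀ {b c b′ c′} → (b ≡ true → b′ ≡ true) → (c ≡ true → c′ ≡ true) →
         b ∨ c ≡ true → b′ ∨ c′ ≡ true
∨-mono {true}           b⇒b′ _    _ rewrite b⇒b′ refl = refl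
∨-mono {false} {b′ = b′} _    c⇒c′ c rewrite c⇒c′ c    = Bool.∨-zeroʳ b′

≢∧false⇒true : ∀ {b c} → b ≢ c → b ≡ false → c ≡ true
≢∧false⇒true {c = true}  _   _ = refl
≢∧false⇒true {c = false} b≢c refl = contradiction refl b≢c

false-contrapositive : ∀ {b c} → (b ≡ true → c ≡ true) → c ≡ false → b ≡ false
false-contrapositive {false} _   _    = refl
false-contrapositive {true}  b⇒c refl = sym (b⇒c refl)

module _ {A : Set} where

  ─-⊑ : ∀ {x : A} {xs} (i : x ∈ xs) → (xs ─ i) ⊑ xs
  ─-⊑ (here refl) = _ ∷ʳ ⊆-refl
  ─-⊑ (there i)   = refl ∷ ─-⊑ i

  length-─ : ∀ {x : A} {xs} (i : x ∈ xs) → length (xs ─ i) < length xs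
  length-─ {xs = xs} i = ≤-reflexive (sym (length-removeAt′ xs _))

  count-─ : ∀ (p : A → Bool) {x xs} (i : x ∈ xs) → count p xs ≡ 𝟙 (p x) + count p (xs ─ i)
  count-─ p (here refl) = refl
  count-─ p {x} {y ∷ _} (there i) =
    trans (cong (𝟙 (p y) +_) (count-─ p i)) (x∙yz≈y∙xz (𝟙 (p y)) (𝟙 (p x)) _)

  count-mono : ∀ {p q : A → Bool} → (∀ x → p x ≡ true → q x ≡ true) →
               ∀ xs → count p xs ≤ count q xs
  count-mono p⇒q []       = z≤n
  count-mono p⇒q (x ∷ xs) = +-mono-≤ (𝟙-mono (p⇒q x)) (count-mono p⇒q xs)

  count-witness : ∀ (p : A → Bool) xs → 0 < count p xs → ∃[ x ] x ∈ xs × p x ≡ true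
  count-witness p (x ∷ xs) pos with p x in px
  ... | true  = x , here refl , px
  ... | false with count-witness p xs pos
  ...   | y , y∈xs , py = y , there y∈xs , py

  sum′≡count : ∀ (f : A → ℕ) (p : A → Bool) xs →
               (∀ {x} → x ∈ xs → f x ≡ 𝟙 (p x)) → sum' f xs ≡ count p xs
  sum′≡count f p []       _   = refl
  sum′≡count f p (x ∷ xs) f≡p = cong₂ _+_ (f≡p (here refl)) (sum′≡count f p xs (f≡p ∘ there))

Edge : ℕ → Set
Edge n = Fin n × Fin n

incidence : ∀ {n} → Fin n → Edge n → ℕ
incidence v (a , b) = 𝟙 (a == v) + 𝟙 (b == v)

joins : ∀ {n} → Fin n → Subset n → Edge n → Bool
joins v D (a , b) = ((a == v) ∧ lookup D b) ∨ ((b == v) ∧ lookup D a)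

links : ∀ {n} → Fin n → Fin n → Edge n → Bool
links x y (a , b) = ((a == x) ∧ (b == y)) ∨ ((a == y) ∧ (b == x))

lookup-∁ : ∀ {n} (D : Subset n) v → lookup (∁ D) v ≡ not (lookup D v)
lookup-∁ D v = lookup-map v not D

joins-mono : ∀ {n} {D D′ : Subset n} → (∀ u → lookup D u ≡ true → lookup D′ u ≡ true) →
             ∀ v e → joins v D e ≡ true → joins v D′ e ≡ true
joins-mono D⊆D′ v (a , b) = ∨-mono (∧-monoʳ (a == v) (D⊆D′ b)) (∧-monoʳ (b == v) (D⊆D′ a))

joins⇒ : ∀ {n} {v : Fin n} {D} a b → joins v D (a , b) ≡ true →
         (a ≡ v × lookup D b ≡ true) ⊎ (b ≡ v × lookup D a ≡ true)
joins⇒ {v = v} {D} a b j with a ≟ᶠ v | b ≟ᶠ v | lookup D a | lookup D b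
... | yes a≡v | _       | _     | true  = inj₁ (a≡v , refl)
... | _       | yes b≡v | true  | _     = inj₂ (b≡v , refl)
... | yes _   | yes _   | false | false = contradiction j λ ()
... | yes _   | no _    | _     | false = contradiction j λ ()
... | no _    | yes _   | false | _     = contradiction j λ ()
... | no _    | no _    | _     | _     = contradiction j λ ()

links⇒ : ∀ {n} {x y : Fin n} a b → links x y (a , b) ≡ true → (a ≡ x × b ≡ y) ⊎ (a ≡ y × b ≡ x)
links⇒ {x = x} {y} a b l with a ≟ᶠ x | b ≟ᶠ y | a ≟ᶠ y | b ≟ᶠ x
... | yes a≡x | yes b≡y | _       | _       = inj₁ (a≡x , b≡y)
... | _       | _       | yes a≡y | yes b≡x = inj₂ (a≡y , b≡x)
... | yes _   | no _    | yes _   | no _    = contradiction l λ ()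
... | yes _   | no _    | no _    | _       = contradiction l λ ()
... | no _    | _       | yes _   | no _    = contradiction l λ ()
... | no _    | _       | no _    | _       = contradiction l λ ()

incidence≡joins : ∀ {n} {D : Subset n} {v} a b → lookup D a ≢ lookup D b → lookup D v ≡ false →
                  incidence v (a , b) ≡ 𝟙 (joins v D (a , b))
incidence≡joins {D = D} {v} a b Da≢Db Dv with a ≟ᶠ v | b ≟ᶠ v
... | yes refl | yes refl = contradiction refl Da≢Db
... | yes refl | no _     rewrite ≢∧false⇒true Da≢Db Dv       = refl
... | no _     | yes refl rewrite ≢∧false⇒true (Da≢Db ∘ sym) Dv = refl
... | no _     | no _     = refl

deleteEdge : (G : Multigraph) {e : Edge (n G)} → e ∈ edges G → Multigraph
deleteEdge G i = mkGraph (n G) (edges G ─ i)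

Crosses : ∀ {n} → Subset n → Edge n → Set
Crosses D (a , b) = lookup D a ≢ lookup D b

Bipartite : (G : Multigraph) → Subset (n G) → Set
Bipartite G D = All (Crosses D) (edges G)

Critical : (G : Multigraph) → Subset (n G) → Vertex G → Set
Critical G D v = lookup D v ≡ false × edgesToSet G v D ≡ 2

critical? : ∀ G D v → Dec (Critical G D v)
critical? G D v = (lookup D v Bool.≟ false) ×-dec (edgesToSet G v D ℕ.≟ 2)

DominatingPartition : (G : Multigraph) → Subset (n G) → Set
DominatingPartition G D = TwoDominating G D × TwoDominating G (∁ D)

EdgeMinimal : Multigraph → Set
EdgeMinimal G = ∀ E → E ⊑ edges G → length E < length (edges G) →
                TwoTwoDominated (mkGraph (n G) E) → ⊥

module _ (G : Multigraph) where

  TwoDominating-mono : ∀ {D D′} → (∀ u → lookup D u ≡ true → lookup D′ u ≡ true) →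
                       TwoDominating G D → TwoDominating G D′
  TwoDominating-mono {D} {D′} D⊆D′ dom v D′v =
    ≤-trans (dom v (false-contrapositive (D⊆D′ v) D′v))
            (count-mono {p = joins v D} {q = joins v D′} (joins-mono {D = D} {D′} D⊆D′ v) (edges G))

  TwoDominating⇒Nonempty : Vertex G → ∀ {D} → TwoDominating G D → Nonempty D
  TwoDominating⇒Nonempty v {D} dom with lookup D v in Dv
  ... | true  = v , lookup⇒[]= v D Dv
  ... | false with count-witness (joins v D) (edges G) (≤-trans (s≤s z≤n) (dom v Dv))
  ...   | (a , b) , _ , j with joins⇒ {D = D} a b j
  ...     | inj₁ (_ , Db) = b , lookup⇒[]= b D Db
  ...     | inj₂ (_ , Da) = a , lookup⇒[]= a D Da

  DominatingPartition⇒TwoTwoDominated : Vertex G → ∀ {D} → DominatingPartition G D →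
                                        TwoTwoDominated G
  DominatingPartition⇒TwoTwoDominated v {D} (dom , dom∁)
    with TwoDominating⇒Nonempty v dom | TwoDominating⇒Nonempty v dom∁
  ... | u , u∈D | w , w∈∁D =
    D , ∁ D , (⊆⊤ , w , ∈⊤ , x∈∁p⇒x∉p w∈∁D) , (⊆⊤ , u , ∈⊤ , x∈p⇒x∉∁p u∈D) ,
    (λ (x , x∈D∩∁D) → uncurry x∈p⇒x∉∁p (x∈p∩q⁻ D (∁ D) x∈D∩∁D)) , dom , dom∁

  TwoTwoDominated⇒DominatingPartition : TwoTwoDominated G → ∃[ D ] DominatingPartition G D
  TwoTwoDominated⇒DominatingPartition (D₁ , D₂ , _ , _ , disjoint , dom₁ , dom₂) =
    D₂ , dom₂ , TwoDominating-mono {D₁} {∁ D₂} D₁⊆∁D₂ dom₁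
    where
    D₁⊆∁D₂ : ∀ u → lookup D₁ u ≡ true → lookup (∁ D₂) u ≡ true
    D₁⊆∁D₂ u D₁u = trans (lookup-∁ D₂ u) (cong not (Bool.¬-not λ D₂u →
      disjoint (u , x∈p∩q⁺ (lookup⇒[]= u D₁ D₁u , lookup⇒[]= u D₂ D₂u))))

  edgesToSet-deleteEdge : ∀ {e} (i : e ∈ edges G) v D →
    edgesToSet G v D ≡ 𝟙 (joins v D e) + edgesToSet (deleteEdge G i) v D
  edgesToSet-deleteEdge i v D = count-─ (joins v D) i

  TwoDominating-deleteEdge⁺ : ∀ {D e} (i : e ∈ edges G) → TwoDominating G D →
    (∀ v → lookup D v ≡ false → joins v D e ≡ true → edgesToSet G v D ≢ 2) →
    TwoDominating (deleteEdge G i) D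
  TwoDominating-deleteEdge⁺ {D} {e} i dom ¬tight v Dv
    with joins v D e in j | edgesToSet-deleteEdge i v D
  ... | false | total≡ = subst (2 ≤_) total≡ (dom v Dv)
  ... | true  | total≡ = s≤s⁻¹ (≤∧≢⇒< (subst (2 ≤_) total≡ (dom v Dv))
                                       (λ 2≡total → ¬tight v Dv j (trans total≡ (sym 2≡total))))

  TwoDominating-deleteEdge : ∀ {D a b} (i : (a , b) ∈ edges G) → TwoDominating G D →
    TwoDominating (deleteEdge G i) D ⊎ (Critical G D a ⊎ Critical G D b)
  TwoDominating-deleteEdge {D} {a} {b} i dom with critical? G D a | critical? G D b
  ... | yes crit | _        = inj₂ (inj₁ crit)
  ... | no _     | yes crit = inj₂ (inj₂ crit)
  ... | no ¬ca   | no ¬cb   = inj₁ (TwoDominating-deleteEdge⁺ {D} i dom ¬tight)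
    where
    ¬tight : ∀ v → lookup D v ≡ false → joins v D (a , b) ≡ true → edgesToSet G v D ≢ 2
    ¬tight v Dv j tight with joins⇒ {D = D} a b j
    ... | inj₁ (refl , _) = ¬ca (Dv , tight)
    ... | inj₂ (refl , _) = ¬cb (Dv , tight)

  TwoDominating-deleteInternalEdge : ∀ {D a b} (i : (a , b) ∈ edges G) →
    lookup D a ≡ lookup D b → TwoDominating G D → TwoDominating (deleteEdge G i) D
  TwoDominating-deleteInternalEdge {D} {a} {b} i Da≡Db dom =
    TwoDominating-deleteEdge⁺ {D} i dom λ v Dv j _ → case joins⇒ {D = D} a b j of λ where
      (inj₁ (refl , Db)) → contradiction (trans (sym Dv) (trans Da≡Db Db)) λ ()
      (inj₂ (refl , Da)) → contradiction (trans (sym Dv) (trans (sym Da≡Db) Da)) λ ()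

  Bipartite⇒degree≡edgesToSet : ∀ {D v} → Bipartite G D → lookup D v ≡ false →
                                degree G v ≡ edgesToSet G v D
  Bipartite⇒degree≡edgesToSet {D} {v} bip Dv =
    sum′≡count (incidence v) (joins v D) (edges G)
      λ { {a , b} i → incidence≡joins {D = D} a b (All.lookup bip i) Dv }

  critical⇒degree≡2 : ∀ {D v} → Bipartite G D → Critical G D v → degree G v ≡ 2
  critical⇒degree≡2 {D} bip (Dv , tight) = trans (Bipartite⇒degree≡edgesToSet {D} bip Dv) tight

  critical-end⇒degree≡2 : ∀ {D a b} → Bipartite G D → Critical G D a ⊎ Critical G D b →
                          degree G a ≡ 2 ⊎ degree G b ≡ 2
  critical-end⇒degree≡2 {D} bip = Sum.map (critical⇒degree≡2 {D} bip) (critical⇒degree≡2 {D} bip)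

Crosses-∁ : ∀ {n} (D : Subset n) e → Crosses D e → Crosses (∁ D) e
Crosses-∁ D (a , b) Da≢Db ∁Da≡∁Db =
  Da≢Db (Bool.not-injective (trans (sym (lookup-∁ D a)) (trans ∁Da≡∁Db (lookup-∁ D b))))

Bipartite-∁ : ∀ {G D} → Bipartite G D → Bipartite G (∁ D)
Bipartite-∁ {D = D} = All.map (Crosses-∁ D _)

module _ {G : Multigraph} (minimal : EdgeMinimal G) where

  deleteEdge-¬TwoTwoDominated : ∀ {e} (i : e ∈ edges G) → ¬ TwoTwoDominated (deleteEdge G i)
  deleteEdge-¬TwoTwoDominated i = minimal _ (─-⊑ i) (length-─ i)

  minimal⇒Bipartite : ∀ {D} → DominatingPartition G D → Bipartite G D
  minimal⇒Bipartite {D} (dom , dom∁) = All.tabulate λ { {a , b} i Da≡Db →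
    deleteEdge-¬TwoTwoDominated i (DominatingPartition⇒TwoTwoDominated (deleteEdge G i) a {D}
      ( TwoDominating-deleteInternalEdge G {D} i Da≡Db dom
      , TwoDominating-deleteInternalEdge G {∁ D} i (∁-cong Da≡Db) dom∁)) }
    where
    ∁-cong : ∀ {a b} → lookup D a ≡ lookup D b → lookup (∁ D) a ≡ lookup (∁ D) b
    ∁-cong {a} {b} Da≡Db = trans (lookup-∁ D a) (trans (cong not Da≡Db) (sym (lookup-∁ D b)))

  minimal⇒endpoint-degree≡2 : TwoTwoDominated G → ∀ {a b} → (a , b) ∈ edges G →
                              degree G a ≡ 2 ⊎ degree G b ≡ 2
  minimal⇒endpoint-degree≡2 dominated {a} i
    with TwoTwoDominated⇒DominatingPartition G dominated
  ... | D , part@(dom , dom∁)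
    with TwoDominating-deleteEdge G {D} i dom | TwoDominating-deleteEdge G {∁ D} i dom∁
  ... | inj₂ crit  | _          =
          critical-end⇒degree≡2 G {D} (minimal⇒Bipartite {D} part) crit
  ... | _          | inj₂ crit  =
          critical-end⇒degree≡2 G {∁ D} (Bipartite-∁ {G} {D} (minimal⇒Bipartite {D} part)) crit
  ... | inj₁ dom′ | inj₁ dom∁′ = ⊥-elim (deleteEdge-¬TwoTwoDominated i
          (DominatingPartition⇒TwoTwoDominated (deleteEdge G i) a {D} (dom′ , dom∁′)))

edgesBetween-edge : ∀ G x y → 0 < edgesBetween G x y → (x , y) ∈ edges G ⊎ (y , x) ∈ edges G
edgesBetween-edge G x y pos with count-witness (links x y) (edges G) pos
... | (a , b) , i , l with links⇒ a b l
...   | inj₁ (refl , refl) = inj₁ i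
...   | inj₂ (refl , refl) = inj₂ i

corollary2p7 : (G : Multigraph) → MinimalTwoTwoDominated G →
    (x y : Vertex G) → ¬ (x ≡ y) → 2 ≤ edgesBetween G x y →
    (degree G x ≡ 2) ⊎ (degree G y ≡ 2)
corollary2p7 G (_ , dominated , minimal) x y _ 2≤xy
  with edgesBetween-edge G x y (≤-trans (s≤s z≤n) 2≤xy)
... | inj₁ xy = minimal⇒endpoint-degree≡2 minimal dominated xy
... | inj₂ yx = Sum.swap (minimal⇒endpoint-degree≡2 minimal dominated yx)
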